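{- Let $n \equiv 0 \pmod 4$ and $m \ge 1$. Then the generalised friendship graph $f_{n,m}$ is group vertex magic.
   Context: The generalised friendship graph $f_{n,m}$ consists of $m$ cycles, each of order $n$, all meeting at a single common vertex. For a non-trivial Abelian group $A$ (not necessarily finite), a graph $G$ is $A$-vertex magic if there exist a labeling $l : V(G) \to A\setminus\{0\}$ and $\mu \in A$ such that $\sum_{u \in N_G(v)} l(u) = \mu$ for every $v \in V(G)$, where $N_G(v)$ is the open neighborhood of $v$. $G$ is group vertex magic if it is $A$-vertex magic for every non-trivial Abelian group $A$. -}

module Defs where

open import Level using (Level; _⊔_; Setω)
open import Data.Bool using (Bool; true; false; _∧_; _∨_; if_then_else_)
open import Data.Nat using (ℕ; zero; suc; _∸_; _≡ᵇ_)
open import Data.Fin using (Fin; toℕ)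
import Data.Fin as F
open import Data.Product using (_×_; _,_; ∃)
open import Relation.Nullary using (¬_; ⌊_⌋)
open import Algebra.Bundles using (AbelianGroup)

-- Vertices of f_{n,m}: the common centre, and for each cycle i ∈ Fin m the
-- n-1 remaining vertices (i , j), j ∈ Fin (n ∸ 1), numbered along the cycle.
-- Cycle i is:  centre - (i,0) - (i,1) - ... - (i,n-2) - centre.
data FVertex (n m : ℕ) : Set where
  centre : FVertex n m
  cyc    : Fin m → Fin (n ∸ 1) → FVertex n m

isEnd : (n : ℕ) → Fin (n ∸ 1) → Bool
isEnd n j = (toℕ j ≡ᵇ 0) ∨ (suc (toℕ j) ≡ᵇ (n ∸ 1))

fAdj : (n m : ℕ) → FVertex n m → FVertex n m → Bool
fAdj n m centre     centre       = false
fAdj n m centre     (cyc i j)    = isEnd n j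
fAdj n m (cyc i j)  centre       = isEnd n j
fAdj n m (cyc i j)  (cyc i' j')  =
  ⌊ i F.≟ i' ⌋ ∧ ((suc (toℕ j) ≡ᵇ toℕ j') ∨ (suc (toℕ j') ≡ᵇ toℕ j))

module _ {c ℓ : Level} (A : AbelianGroup c ℓ) where
  open AbelianGroup A renaming (Carrier to G)

  sumFin : (k : ℕ) → (Fin k → G) → G
  sumFin zero    f = ε
  sumFin (suc k) f = f F.zero ∙ sumFin k (λ i → f (F.suc i))

  sumV : (n m : ℕ) → (FVertex n m → G) → G
  sumV n m f = f centre ∙ sumFin m (λ i → sumFin (n ∸ 1) (λ j → f (cyc i j)))

  nbhdSum : (n m : ℕ) → (FVertex n m → G) → FVertex n m → G
  nbhdSum n m l v = sumV n m (λ u → if fAdj n m v u then l u else ε)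

  NonTrivial : Set (c ⊔ ℓ)
  NonTrivial = ∃ λ (x : G) → ¬ (x ≈ ε)

  IsAVertexMagic-f : (n m : ℕ) → Set (c ⊔ ℓ)
  IsAVertexMagic-f n m =
    ∃ λ (l : FVertex n m → G) → ∃ λ (μ : G) →
      ((v : FVertex n m) → ¬ (l v ≈ ε)) × ((v : FVertex n m) → nbhdSum n m l v ≈ μ)

GroupVertexMagic-f : (n m : ℕ) → Setω
GroupVertexMagic-f n m =
  ∀ {c ℓ : Level} (A : AbelianGroup c ℓ) → NonTrivial A → IsAVertexMagic-f A n m

-- Read each cycle of f_{n,m} as positions 0, 1, …, n - 1 with the centre at position 0,
-- and label position p by the p-th term of a, a, -a, -a, a, a, … .  The two cycle
-- neighbours of position p sit at p - 1 and p + 1, whose labels cancel; as 4 ∣ n the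
-- sequence is n-periodic, so this persists when a neighbour is the centre.  Each cycle
-- contributes a + (-a) to the centre's neighbourhood, so every neighbourhood sums to 0.

module Submission where

open import Defs
open import Data.Nat using (ℕ; _%_; _≥_)
open import Relation.Binary.PropositionalEquality using (_≡_)

open import Level using (Level)
open import Data.Bool using (Bool; true; false; T; _∧_; _∨_; if_then_else_)
open import Data.Empty using (⊥)
open import Data.Fin using (Fin; toℕ; _≟_)
import Data.Fin as F
open import Data.Fin.Properties using (toℕ<n)
open import Data.Nat using (zero; suc; _+_; _∸_; _*_; _≡ᵇ_; _<ᵇ_; _<_; s≤s)
open import Data.Nat.Divisibility using (_∣_; divides; m%n≡0⇒n∣m)
open import Data.Nat.Properties
  using (≡ᵇ⇒≡; ≡⇒≡ᵇ; <ᵇ⇒<; <⇒<ᵇ; +-comm; <⇒≢; n≮n; m≤n⇒m<n∨m≡n; m+1+n≢n; ≤-refl; ≤-trans; n≤1+n)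
open import Data.Product using (_,_)
open import Function using (_∘_)
open import Data.Sum using (inj₁; inj₂)
open import Relation.Nullary using (¬_; ⌊_⌋)
open import Relation.Nullary.Decidable using (⌊⌋-map′)
import Relation.Binary.PropositionalEquality as ≡
open import Algebra.Bundles using (AbelianGroup)

≡ᵇ-sym : ∀ m n → (m ≡ᵇ n) ≡ (n ≡ᵇ m)
≡ᵇ-sym zero    zero    = ≡.refl
≡ᵇ-sym zero    (suc n) = ≡.refl
≡ᵇ-sym (suc m) zero    = ≡.refl
≡ᵇ-sym (suc m) (suc n) = ≡ᵇ-sym m n

module _ {a} {A : Set a} {x y : A} where

  if-true : ∀ {b} → T b → (if b then x else y) ≡ x
  if-true {true} _ = ≡.refl

  if-false : ∀ {b} → ¬ T b → (if b then x else y) ≡ y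
  if-false {false} _ = ≡.refl
  if-false {true}  ¬t with () ← ¬t _

module _ {c ℓ : Level} (A : AbelianGroup c ℓ) where
  open AbelianGroup A renaming (Carrier to G)
  open import Algebra.Properties.CommutativeMonoid.Sum commutativeMonoid
    using (sum; sum-cong-≋; sum-cong-≗; sum-replicate-zero; ∑-distrib-+)
  open import Algebra.Properties.CommutativeSemigroup commutativeSemigroup using (interchange)
  open import Algebra.Properties.Group group using (ε⁻¹≈ε; ⁻¹-injective)
  open import Relation.Binary.Reasoning.Setoid setoid

  sumFin≡sum : ∀ k (f : Fin k → G) → sumFin A k f ≡ sum f
  sumFin≡sum zero    f = ≡.refl
  sumFin≡sum (suc k) f = ≡.cong (f F.zero ∙_) (sumFin≡sum k (λ i → f (F.suc i)))

  sum-zero : ∀ {k} {f : Fin k → G} → (∀ i → f i ≈ ε) → sum f ≈ ε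
  sum-zero {k} f≈ε = trans (sum-cong-≋ f≈ε) (sum-replicate-zero k)

  if-∨ : ∀ X Y (v : G) → (T X → T Y → ⊥) →
         (if X ∨ Y then v else ε) ≈ (if X then v else ε) ∙ (if Y then v else ε)
  if-∨ true  Y v disjoint = sym (trans (∙-congˡ (reflexive (if-false (disjoint _)))) (identityʳ _))
  if-∨ false Y v disjoint = sym (identityˡ _)

  sum-if-∧ : ∀ {k} c (b : Fin k → Bool) (f : Fin k → G) →
             sum (λ j → if c ∧ b j then f j else ε) ≈ (if c then sum (λ j → if b j then f j else ε) else ε)
  sum-if-∧     true  b f = refl
  sum-if-∧ {k} false b f = sum-zero {k} (λ _ → refl)

  sum-select-Fin : ∀ k (i : Fin k) (f : Fin k → G) → sum (λ i′ → if ⌊ i ≟ i′ ⌋ then f i′ else ε) ≈ f i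
  sum-select-Fin (suc k) F.zero    f = trans (∙-congˡ (sum-zero {k} (λ _ → refl))) (identityʳ _)
  sum-select-Fin (suc k) (F.suc i) f = begin
    ε ∙ sum (λ i′ → if ⌊ F.suc i ≟ F.suc i′ ⌋ then f (F.suc i′) else ε)
      ≈⟨ identityˡ _ ⟩
    sum (λ i′ → if ⌊ F.suc i ≟ F.suc i′ ⌋ then f (F.suc i′) else ε)
      ≡⟨ sum-cong-≗ (λ i′ → ≡.cong (if_then f (F.suc i′) else ε) (⌊⌋-map′ _ _ (i ≟ i′))) ⟩
    sum (λ i′ → if ⌊ i ≟ i′ ⌋ then f (F.suc i′) else ε)
      ≈⟨ sum-select-Fin k i (λ i′ → f (F.suc i′)) ⟩
    f (F.suc i) ∎

  sum-select : ∀ k q (h : ℕ → G) → sum {k} (λ j → if toℕ j ≡ᵇ q then h (toℕ j) else ε) ≈ (if q <ᵇ k then h q else ε)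
  sum-select zero    q       h = refl
  sum-select (suc k) zero    h = trans (∙-congˡ (sum-zero {k} (λ _ → refl))) (identityʳ _)
  sum-select (suc k) (suc q) h = trans (identityˡ _) (sum-select k q (λ t → h (suc t)))

  nbhdSum≡ : ∀ n m (l : FVertex n m → G) v →
             nbhdSum A n m l v ≡ (if fAdj n m v centre then l centre else ε)
                                 ∙ sum (λ i → sum (λ j → if fAdj n m v (cyc i j) then l (cyc i j) else ε))
  nbhdSum≡ n m l v = ≡.cong (_ ∙_) (≡.trans (sumFin≡sum m _) (sum-cong-≗ {m} (λ i → sumFin≡sum (n ∸ 1) _)))

  module PeriodicLabelling (K m : ℕ) (t : ℕ → G)
      (t-nonzero : ∀ p → ¬ t p ≈ ε)
      (t-antiperiodic : ∀ p → t (2 + p) ∙ t p ≈ ε)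
      (t-periodic : ∀ p → t (p + (3 + K)) ≈ t p) where

    -- Vertex (i , j) sits at position suc (toℕ j) of cycle i, the centre at 0 and at n.

    N n : ℕ
    N = 2 + K
    n = suc N

    labelling : FVertex n m → G
    labelling centre    = t 0
    labelling (cyc i j) = t (suc (toℕ j))

    centreIf : Bool → G
    centreIf b = if b then t 0 else ε

    pathSuccessor pathPredecessor : ℕ → G
    pathSuccessor   p = sum {N} (λ j → if toℕ j ≡ᵇ suc p then t (suc (toℕ j)) else ε)
    pathPredecessor p = sum {N} (λ j → if suc (toℕ j) ≡ᵇ p then t (suc (toℕ j)) else ε)

    ends-disjoint : ∀ x → T (x ≡ᵇ 0) → T (x ≡ᵇ suc K) → ⊥
    ends-disjoint zero    _ ()
    ends-disjoint (suc x) ()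

    ends-sum : sum {N} (λ j → if isEnd n j then t (suc (toℕ j)) else ε) ≈ ε
    ends-sum = begin
      sum {N} (λ j → if isEnd n j then t (suc (toℕ j)) else ε)
        ≈⟨ sum-cong-≋ {N} (λ j → if-∨ (toℕ j ≡ᵇ 0) (toℕ j ≡ᵇ suc K) (t (suc (toℕ j))) (ends-disjoint (toℕ j))) ⟩
      sum {N} (λ j → atFirst j ∙ atLast j)
        ≈⟨ ∑-distrib-+ {N} atFirst atLast ⟩
      sum {N} atFirst ∙ sum {N} atLast
        ≈⟨ ∙-cong (sum-select N 0 (λ q → t (suc q))) (sum-select N (suc K) (λ q → t (suc q))) ⟩
      t 1 ∙ (if suc K <ᵇ N then t N else ε)
        ≡⟨ ≡.cong (t 1 ∙_) (if-true (<⇒<ᵇ (≤-refl {N}))) ⟩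
      t 1 ∙ t N
        ≈⟨ ∙-congʳ (sym (t-periodic 1)) ⟩
      t (2 + N) ∙ t N
        ≈⟨ t-antiperiodic N ⟩
      ε ∎
      where
      atFirst atLast : Fin N → G
      atFirst j = if toℕ j ≡ᵇ 0 then t (suc (toℕ j)) else ε
      atLast  j = if toℕ j ≡ᵇ suc K then t (suc (toℕ j)) else ε

    centre-sum : nbhdSum A n m labelling centre ≈ ε
    centre-sum = begin
      nbhdSum A n m labelling centre
        ≡⟨ nbhdSum≡ n m labelling centre ⟩
      ε ∙ sum {m} (λ i → sum {N} (λ j → if isEnd n j then t (suc (toℕ j)) else ε))
        ≈⟨ identityˡ _ ⟩
      sum {m} (λ i → sum {N} (λ j → if isEnd n j then t (suc (toℕ j)) else ε))
        ≈⟨ sum-zero {m} (λ _ → ends-sum) ⟩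
      ε ∎

    predecessor-label : ∀ p → p < N → centreIf (p ≡ᵇ 0) ∙ pathPredecessor p ≈ t p
    predecessor-label zero    _   = trans (∙-congˡ (sum-zero {N} (λ _ → refl))) (identityʳ _)
    predecessor-label (suc p) p<N = begin
      ε ∙ pathPredecessor (suc p)         ≈⟨ identityˡ _ ⟩
      pathPredecessor (suc p)             ≈⟨ sum-select N p (λ q → t (suc q)) ⟩
      (if p <ᵇ N then t (suc p) else ε)   ≡⟨ if-true (<⇒<ᵇ (≤-trans (n≤1+n (suc p)) p<N)) ⟩
      t (suc p)                           ∎

    successor-label : ∀ p → p < N → centreIf (suc p ≡ᵇ N) ∙ pathSuccessor p ≈ t (2 + p)
    successor-label p p<N with m≤n⇒m<n∨m≡n p<N
    ... | inj₁ inner = begin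
      centreIf (suc p ≡ᵇ N) ∙ pathSuccessor p
        ≈⟨ ∙-cong (reflexive (if-false (<⇒≢ inner ∘ ≡ᵇ⇒≡ (suc p) N))) (sum-select N (suc p) (λ q → t (suc q))) ⟩
      ε ∙ (if suc p <ᵇ N then t (2 + p) else ε)
        ≡⟨ ≡.cong (ε ∙_) (if-true (<⇒<ᵇ inner)) ⟩
      ε ∙ t (2 + p)
        ≈⟨ identityˡ _ ⟩
      t (2 + p) ∎
    ... | inj₂ ≡.refl = begin
      centreIf (N ≡ᵇ N) ∙ pathSuccessor (suc K)
        ≈⟨ ∙-cong (reflexive (if-true (≡⇒≡ᵇ N N ≡.refl))) (sum-select N N (λ q → t (suc q))) ⟩
      t 0 ∙ (if N <ᵇ N then t n else ε)
        ≡⟨ ≡.cong (t 0 ∙_) (if-false (n≮n N ∘ <ᵇ⇒< N N)) ⟩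
      t 0 ∙ ε
        ≈⟨ identityʳ _ ⟩
      t 0
        ≈⟨ sym (t-periodic 0) ⟩
      t n ∎

    path-disjoint : ∀ p x → T (x ≡ᵇ suc p) → T (suc x ≡ᵇ p) → ⊥
    path-disjoint p x x≡1+p 1+x≡p =
      m+1+n≢n 1 (≡.trans (≡.cong suc (≡.sym (≡ᵇ⇒≡ x (suc p) x≡1+p))) (≡ᵇ⇒≡ (suc x) p 1+x≡p))

    path-neighbours : ∀ (i : Fin m) (j : Fin N) →
      sum {m} (λ i′ → sum {N} (λ j′ → if fAdj n m (cyc i j) (cyc i′ j′) then labelling (cyc i′ j′) else ε))
        ≈ pathSuccessor (toℕ j) ∙ pathPredecessor (toℕ j)
    path-neighbours i j = begin
      sum {m} (λ i′ → sum {N} (λ j′ → if ⌊ i ≟ i′ ⌋ ∧ adjacent j′ then label j′ else ε))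
        ≈⟨ sum-cong-≋ {m} (λ i′ → sum-if-∧ ⌊ i ≟ i′ ⌋ adjacent label) ⟩
      sum {m} (λ i′ → if ⌊ i ≟ i′ ⌋ then sum {N} (λ j′ → if adjacent j′ then label j′ else ε) else ε)
        ≈⟨ sum-select-Fin m i _ ⟩
      sum {N} (λ j′ → if adjacent j′ then label j′ else ε)
        ≡⟨ sum-cong-≗ {N} (λ j′ → ≡.cong (λ b → if b ∨ (suc (toℕ j′) ≡ᵇ p) then label j′ else ε) (≡ᵇ-sym (suc p) (toℕ j′))) ⟩
      sum {N} (λ j′ → if (toℕ j′ ≡ᵇ suc p) ∨ (suc (toℕ j′) ≡ᵇ p) then label j′ else ε)
        ≈⟨ sum-cong-≋ {N} (λ j′ → if-∨ _ _ (label j′) (path-disjoint p (toℕ j′))) ⟩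
      sum {N} (λ j′ → after j′ ∙ before j′)
        ≈⟨ ∑-distrib-+ {N} after before ⟩
      pathSuccessor p ∙ pathPredecessor p ∎
      where
      p = toℕ j
      adjacent : Fin N → Bool
      adjacent j′ = (suc p ≡ᵇ toℕ j′) ∨ (suc (toℕ j′) ≡ᵇ p)
      label after before : Fin N → G
      label  j′ = t (suc (toℕ j′))
      after  j′ = if toℕ j′ ≡ᵇ suc p then label j′ else ε
      before j′ = if suc (toℕ j′) ≡ᵇ p then label j′ else ε

    cycle-sum : ∀ i j → nbhdSum A n m labelling (cyc i j) ≈ ε
    cycle-sum i j = begin
      nbhdSum A n m labelling (cyc i j)
        ≡⟨ nbhdSum≡ n m labelling (cyc i j) ⟩
      centreIf (isEnd n j) ∙ _
        ≈⟨ ∙-cong (if-∨ (p ≡ᵇ 0) (suc p ≡ᵇ N) (t 0) (ends-disjoint p)) (path-neighbours i j) ⟩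
      (centreIf (p ≡ᵇ 0) ∙ centreIf (suc p ≡ᵇ N)) ∙ (pathSuccessor p ∙ pathPredecessor p)
        ≈⟨ ∙-congʳ (comm _ _) ⟩
      (centreIf (suc p ≡ᵇ N) ∙ centreIf (p ≡ᵇ 0)) ∙ (pathSuccessor p ∙ pathPredecessor p)
        ≈⟨ interchange _ _ _ _ ⟩
      (centreIf (suc p ≡ᵇ N) ∙ pathSuccessor p) ∙ (centreIf (p ≡ᵇ 0) ∙ pathPredecessor p)
        ≈⟨ ∙-cong (successor-label p (toℕ<n j)) (predecessor-label p (toℕ<n j)) ⟩
      t (2 + p) ∙ t p
        ≈⟨ t-antiperiodic p ⟩
      ε ∎
      where
      p = toℕ j

    labelling-nonzero : ∀ v → ¬ labelling v ≈ ε
    labelling-nonzero centre    = t-nonzero 0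
    labelling-nonzero (cyc i j) = t-nonzero (suc (toℕ j))

    vertex-sum : ∀ v → nbhdSum A n m labelling v ≈ ε
    vertex-sum centre    = centre-sum
    vertex-sum (cyc i j) = cycle-sum i j

    vertexMagic : IsAVertexMagic-f A n m
    vertexMagic = labelling , ε , labelling-nonzero , vertex-sum

  alternatingPairs : G → ℕ → G
  alternatingPairs a 0 = a
  alternatingPairs a 1 = a
  alternatingPairs a 2 = a ⁻¹
  alternatingPairs a 3 = a ⁻¹
  alternatingPairs a (suc (suc (suc (suc p)))) = alternatingPairs a p

  alternatingPairs-nonzero : ∀ {a} → ¬ a ≈ ε → ∀ p → ¬ alternatingPairs a p ≈ ε
  alternatingPairs-nonzero a≉ε 0 = a≉ε
  alternatingPairs-nonzero a≉ε 1 = a≉ε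
  alternatingPairs-nonzero a≉ε 2 = λ a⁻¹≈ε → a≉ε (⁻¹-injective (trans a⁻¹≈ε (sym ε⁻¹≈ε)))
  alternatingPairs-nonzero a≉ε 3 = alternatingPairs-nonzero a≉ε 2
  alternatingPairs-nonzero a≉ε (suc (suc (suc (suc p)))) = alternatingPairs-nonzero a≉ε p

  alternatingPairs-antiperiodic : ∀ a p → alternatingPairs a (2 + p) ∙ alternatingPairs a p ≈ ε
  alternatingPairs-antiperiodic a 0 = inverseˡ a
  alternatingPairs-antiperiodic a 1 = inverseˡ a
  alternatingPairs-antiperiodic a 2 = inverseʳ a
  alternatingPairs-antiperiodic a 3 = inverseʳ a
  alternatingPairs-antiperiodic a (suc (suc (suc (suc p)))) = alternatingPairs-antiperiodic a p

  alternatingPairs-periodic : ∀ a {n} → 4 ∣ n → ∀ p → alternatingPairs a (p + n) ≈ alternatingPairs a p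
  alternatingPairs-periodic a (divides q ≡.refl) p =
    reflexive (≡.trans (≡.cong (alternatingPairs a) (+-comm p (q * 4))) (shift q))
    where
    shift : ∀ q → alternatingPairs a (q * 4 + p) ≡ alternatingPairs a p
    shift zero    = ≡.refl
    shift (suc q) = shift q

mainTheorem14 : (n m : ℕ) → n % 4 ≡ 0 → n ≥ 4 → m ≥ 1 → GroupVertexMagic-f n m
mainTheorem14 (suc (suc (suc (suc k)))) m n%4≡0 (s≤s (s≤s (s≤s (s≤s _)))) _ A (a , a≉ε) =
  PeriodicLabelling.vertexMagic A (suc k) m (alternatingPairs A a)
    (alternatingPairs-nonzero A a≉ε)
    (alternatingPairs-antiperiodic A a)
    (alternatingPairs-periodic A a (m%n≡0⇒n∣m _ 4 n%4≡0))
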